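{- If $A$ and $B$ are output types of System $\mathcal F$, then $A\wedge B$, $A\vee B$ and $LA$ are output types.
   Context: System $\mathcal F$: types are built from type variables (and type constants) with $\rightarrow$ and $\forall$ (only types where quantified variables occur in their scope); typing $\Gamma\vdash_{\mathcal F}t:A$ of pure $\lambda$-terms by (ax), ($\rightarrow_i$), ($\rightarrow_e$), ($\forall_i$): from $\Gamma\vdash t:A$, $X$ not free in $\Gamma$, infer $\Gamma\vdash t:\forall XA$, and ($\forall_e$): from $\Gamma\vdash t:\forall XA$ infer $\Gamma\vdash t:A[C/X]$. A closed type $S$ is an output type iff for every $\beta$-normal $\lambda$-term $t$, $\vdash_{\mathcal F}\lambda xt:\forall X(X\rightarrow S)$ implies $x\notin Fv(t)$. Here $A\wedge B=\forall X\{(A\rightarrow(B\rightarrow X))\rightarrow X\}$, $A\vee B=\forall X\{(A\rightarrow X)\rightarrow((B\rightarrow X)\rightarrow X)\}$, and $LA=\forall X\{X\rightarrow[(A\rightarrow(X\rightarrow X))\rightarrow X]\}$, with $X$ not free in $A,B$. -}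

module Defs where

open import Data.Nat using (ℕ; zero; suc; _<_; _<ᵇ_; _≡ᵇ_; pred)
open import Data.Bool using (if_then_else_)
open import Data.List using (List; []; _∷_; map)
open import Data.Product using (_×_)
open import Data.Sum using (_⊎_)
open import Data.Empty using (⊥)
open import Data.Unit using (⊤)
open import Relation.Binary.PropositionalEquality using (_≡_)
open import Relation.Nullary using (¬_)

data Type : Set where
  tvar : ℕ → Type          -- type variable (de Bruijn index)
  tcon : ℕ → Type
  _⇒_  : Type → Type → Type
  `∀   : Type → Type        -- ∀X A, X bound as index 0

infixr 7 _⇒_

shift : ℕ → Type → Type
shift c (tvar n) = if n <ᵇ c then tvar n else tvar (suc n)
shift c (tcon k) = tcon k
shift c (A ⇒ B)  = shift c A ⇒ shift c B
shift c (`∀ A)   = `∀ (shift (suc c) A)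

shiftBy : ℕ → Type → Type
shiftBy zero    A = A
shiftBy (suc k) A = shift 0 (shiftBy k A)

-- capture-avoiding substitution of C for the variable with index k
-- (variables above k are decremented, since the binder disappears)
subst : ℕ → Type → Type → Type
subst k C (tvar n) =
  if n <ᵇ k then tvar n else (if n ≡ᵇ k then shiftBy k C else tvar (pred n))
subst k C (tcon j) = tcon j
subst k C (A ⇒ B)  = subst k C A ⇒ subst k C B
subst k C (`∀ A)   = `∀ (subst (suc k) C A)

_[_] : Type → Type → Type
A [ C ] = subst 0 C A

Occurs : ℕ → Type → Set
Occurs n (tvar m) = m ≡ n
Occurs n (tcon k) = ⊥
Occurs n (A ⇒ B)  = Occurs n A ⊎ Occurs n B
Occurs n (`∀ A)   = Occurs (suc n) A

FreeBelow : ℕ → Type → Set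
FreeBelow d (tvar m) = m < d
FreeBelow d (tcon k) = ⊤
FreeBelow d (A ⇒ B)  = FreeBelow d A × FreeBelow d B
FreeBelow d (`∀ A)   = FreeBelow (suc d) A

Closed : Type → Set
Closed = FreeBelow 0

-- "only types where quantified variables occur in their scope"
WF : Type → Set
WF (tvar m) = ⊤
WF (tcon k) = ⊤
WF (A ⇒ B)  = WF A × WF B
WF (`∀ A)   = WF A × Occurs 0 A

data Term : Set where
  var : ℕ → Term
  lam : Term → Term
  app : Term → Term → Term

FreeIn : ℕ → Term → Set
FreeIn k (var n)   = n ≡ k
FreeIn k (lam t)   = FreeIn (suc k) t
FreeIn k (app t u) = FreeIn k t ⊎ FreeIn k u

mutual
  data Neutral : Term → Set where
    var : ∀ n → Neutral (var n)
    app : ∀ {t u} → Neutral t → Normal u → Neutral (app t u)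

  data Normal : Term → Set where
    ne  : ∀ {t} → Neutral t → Normal t
    lam : ∀ {t} → Normal t → Normal (lam t)

Ctx : Set
Ctx = List Type

data _∋_∶_ : Ctx → ℕ → Type → Set where
  here  : ∀ {Γ A} → (A ∷ Γ) ∋ zero ∶ A
  there : ∀ {Γ A B n} → Γ ∋ n ∶ A → (B ∷ Γ) ∋ suc n ∶ A

infix 4 _⊢_∶_ _∋_∶_

data _⊢_∶_ : Ctx → Term → Type → Set where
  ax  : ∀ {Γ x A} → Γ ∋ x ∶ A → Γ ⊢ var x ∶ A
  →i  : ∀ {Γ t A B} → WF A → (A ∷ Γ) ⊢ t ∶ B → Γ ⊢ lam t ∶ A ⇒ B
  →e  : ∀ {Γ t u A B} → Γ ⊢ t ∶ A ⇒ B → Γ ⊢ u ∶ A → Γ ⊢ app t u ∶ B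
  -- X not free in Γ: realised by shifting Γ past the new binder
  ∀i  : ∀ {Γ t A} → Occurs 0 A → map (shift 0) Γ ⊢ t ∶ A → Γ ⊢ t ∶ `∀ A
  ∀e  : ∀ {Γ t A} (C : Type) → WF C → Γ ⊢ t ∶ `∀ A → Γ ⊢ t ∶ A [ C ]

IsOutput : Type → Set
IsOutput S =
  Closed S × WF S ×
  (∀ (t : Term) → Normal t →
     [] ⊢ lam t ∶ `∀ (tvar 0 ⇒ shift 0 S) → ¬ FreeIn 0 t)

-- Connectives (X is index 0; A, B shifted so X is not free in them)

_∧_ : Type → Type → Type
A ∧ B = `∀ ((shift 0 A ⇒ (shift 0 B ⇒ tvar 0)) ⇒ tvar 0)

_∨_ : Type → Type → Type
A ∨ B = `∀ ((shift 0 A ⇒ tvar 0) ⇒ ((shift 0 B ⇒ tvar 0) ⇒ tvar 0))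

L : Type → Type
L A = `∀ (tvar 0 ⇒ ((shift 0 A ⇒ (tvar 0 ⇒ tvar 0)) ⇒ tvar 0))

module Submission where

-- Each connective S is an impredicative encoding ∀Y(H₁ ⇒ … ⇒ Hₙ ⇒ Y) whose
-- "constructor types" Hᵢ = P₁ ⇒ … ⇒ Pₘ ⇒ Y have premises Y or A, B.  Given a
-- normal t with ⊢ λx.t : ∀X(X ⇒ S), inversion of the typing peels off the outer
-- abstractions: t = λc₁ … λcₙ. s with s : Y under c₁ : H₁, …, cₙ : Hₙ, x : X.
-- Since s is normal of variable type Y, it is a constructor cᵢ applied to all of
-- its premises, so an occurrence of x lies in an argument of type Y (handled by
-- induction on size) or of type A (or B).  In the latter case we identify Y
-- with X and eliminate every cⱼ (replacing cⱼ e₁ … e_l by λy_{l+1} … λyₘ. x);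
-- this yields a normal term of type A under x : X still containing x, which
-- contradicts that A is an output type.

open import Defs
open import Data.Nat using (ℕ; zero; suc; _+_; _∸_; _<ᵇ_; _≡ᵇ_; pred; _<_; _≤_; z≤n; s≤s; s≤s⁻¹)
open import Data.Nat.Properties
  using (+-comm; +-suc; +-identityʳ; +-cancelˡ-≡; n∸n≡0; ≤-refl; ≤-trans; m≤m+n; m≤n+m; <-trans; <-≤-trans)
open import Data.Bool using (true; false; if_then_else_)
open import Data.Maybe using (Maybe; just; nothing)
open import Data.List using (List; []; _∷_; map; _++_; length)
open import Data.List.Properties using (++-assoc; length-++; map-++; length-map)
open import Data.List.Relation.Unary.All using (All; []; _∷_)
import Data.List.Relation.Unary.All.Properties as All
open import Data.Product using (_×_; _,_; Σ; proj₂)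
open import Data.Sum using (_⊎_; inj₁; inj₂)
import Data.Sum as Sum
open import Data.Unit using (⊤; tt)
open import Data.Empty using (⊥; ⊥-elim)
open import Relation.Nullary using (¬_)
open import Relation.Binary.PropositionalEquality
  using (_≡_; refl; sym; trans; cong; cong₂; module ≡-Reasoning)
  renaming (subst to transport; subst₂ to transport₂)
open ≡-Reasoning

-- The operations
-- shift and subst of Defs are instances of them (see below), so their
-- commutation laws follow from the usual fusion laws proved here.

ext : (ℕ → ℕ) → ℕ → ℕ
ext ρ zero    = zero
ext ρ (suc n) = suc (ρ n)

ren : (ℕ → ℕ) → Type → Type
ren ρ (tvar n) = tvar (ρ n)
ren ρ (tcon k) = tcon k
ren ρ (A ⇒ B)  = ren ρ A ⇒ ren ρ B
ren ρ (`∀ A)   = `∀ (ren (ext ρ) A)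

exts : (ℕ → Type) → ℕ → Type
exts σ zero    = tvar zero
exts σ (suc n) = ren suc (σ n)

sub : (ℕ → Type) → Type → Type
sub σ (tvar n) = σ n
sub σ (tcon k) = tcon k
sub σ (A ⇒ B)  = sub σ A ⇒ sub σ B
sub σ (`∀ A)   = `∀ (sub (exts σ) A)

ren-cong : ∀ {ρ ρ'} → (∀ n → ρ n ≡ ρ' n) → ∀ T → ren ρ T ≡ ren ρ' T
ren-cong e (tvar n) = cong tvar (e n)
ren-cong e (tcon k) = refl
ren-cong e (A ⇒ B)  = cong₂ _⇒_ (ren-cong e A) (ren-cong e B)
ren-cong e (`∀ A)   = cong `∀ (ren-cong e' A)
  where
    e' : ∀ n → ext _ n ≡ ext _ n
    e' zero    = refl
    e' (suc n) = cong suc (e n)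

sub-cong : ∀ {σ σ'} → (∀ n → σ n ≡ σ' n) → ∀ T → sub σ T ≡ sub σ' T
sub-cong e (tvar n) = e n
sub-cong e (tcon k) = refl
sub-cong e (A ⇒ B)  = cong₂ _⇒_ (sub-cong e A) (sub-cong e B)
sub-cong e (`∀ A)   = cong `∀ (sub-cong e' A)
  where
    e' : ∀ n → exts _ n ≡ exts _ n
    e' zero    = refl
    e' (suc n) = cong (ren suc) (e n)

ren-ren : ∀ ρ ρ' T → ren ρ (ren ρ' T) ≡ ren (λ n → ρ (ρ' n)) T
ren-ren ρ ρ' (tvar n) = refl
ren-ren ρ ρ' (tcon k) = refl
ren-ren ρ ρ' (A ⇒ B)  = cong₂ _⇒_ (ren-ren ρ ρ' A) (ren-ren ρ ρ' B)
ren-ren ρ ρ' (`∀ A)   =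
  cong `∀ (trans (ren-ren (ext ρ) (ext ρ') A) (ren-cong e A))
  where
    e : ∀ n → ext ρ (ext ρ' n) ≡ ext (λ n → ρ (ρ' n)) n
    e zero    = refl
    e (suc n) = refl

sub-ren : ∀ σ ρ T → sub σ (ren ρ T) ≡ sub (λ n → σ (ρ n)) T
sub-ren σ ρ (tvar n) = refl
sub-ren σ ρ (tcon k) = refl
sub-ren σ ρ (A ⇒ B)  = cong₂ _⇒_ (sub-ren σ ρ A) (sub-ren σ ρ B)
sub-ren σ ρ (`∀ A)   =
  cong `∀ (trans (sub-ren (exts σ) (ext ρ) A) (sub-cong e A))
  where
    e : ∀ n → exts σ (ext ρ n) ≡ exts (λ n → σ (ρ n)) n
    e zero    = refl
    e (suc n) = refl

ren-sub : ∀ ρ σ T → ren ρ (sub σ T) ≡ sub (λ n → ren ρ (σ n)) T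
ren-sub ρ σ (tvar n) = refl
ren-sub ρ σ (tcon k) = refl
ren-sub ρ σ (A ⇒ B)  = cong₂ _⇒_ (ren-sub ρ σ A) (ren-sub ρ σ B)
ren-sub ρ σ (`∀ A)   =
  cong `∀ (trans (ren-sub (ext ρ) (exts σ) A) (sub-cong e A))
  where
    e : ∀ n → ren (ext ρ) (exts σ n) ≡ exts (λ n → ren ρ (σ n)) n
    e zero    = refl
    e (suc n) = trans (ren-ren (ext ρ) suc (σ n)) (sym (ren-ren suc ρ (σ n)))

sub-sub : ∀ σ τ T → sub σ (sub τ T) ≡ sub (λ n → sub σ (τ n)) T
sub-sub σ τ (tvar n) = refl
sub-sub σ τ (tcon k) = refl
sub-sub σ τ (A ⇒ B)  = cong₂ _⇒_ (sub-sub σ τ A) (sub-sub σ τ B)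
sub-sub σ τ (`∀ A)   =
  cong `∀ (trans (sub-sub (exts σ) (exts τ) A) (sub-cong e A))
  where
    e : ∀ n → sub (exts σ) (exts τ n) ≡ exts (λ n → sub σ (τ n)) n
    e zero    = refl
    e (suc n) = trans (sub-ren (exts σ) suc (τ n)) (sym (ren-sub suc σ (τ n)))

sub-id : ∀ T → sub tvar T ≡ T
sub-id (tvar n) = refl
sub-id (tcon k) = refl
sub-id (A ⇒ B)  = cong₂ _⇒_ (sub-id A) (sub-id B)
sub-id (`∀ A)   = cong `∀ (trans (sub-cong e A) (sub-id A))
  where
    e : ∀ n → exts tvar n ≡ tvar n
    e zero    = refl
    e (suc n) = refl

shiftVar : ℕ → ℕ → ℕ
shiftVar c n = if n <ᵇ c then n else suc n

shift≡ren : ∀ c T → shift c T ≡ ren (shiftVar c) T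
shift≡ren c (tvar n) with n <ᵇ c
... | true  = refl
... | false = refl
shift≡ren c (tcon k) = refl
shift≡ren c (A ⇒ B)  = cong₂ _⇒_ (shift≡ren c A) (shift≡ren c B)
shift≡ren c (`∀ A)   = cong `∀ (trans (shift≡ren (suc c) A) (sym (ren-cong e A)))
  where
    e : ∀ n → ext (shiftVar c) n ≡ shiftVar (suc c) n
    e zero = refl
    e (suc n) with n <ᵇ c
    ... | true  = refl
    ... | false = refl

shift0≡ren : ∀ T → shift 0 T ≡ ren suc T
shift0≡ren = shift≡ren 0

substVar : ℕ → Type → ℕ → Type
substVar k C n =
  if n <ᵇ k then tvar n else (if n ≡ᵇ k then shiftBy k C else tvar (pred n))

exts-substVar : ∀ k C n → ren suc (substVar k C n) ≡ substVar (suc k) C (suc n)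
exts-substVar zero    C zero    = sym (shift0≡ren C)
exts-substVar (suc k) C zero    = refl
exts-substVar zero    C (suc n) = refl
exts-substVar (suc k) C (suc n) with n <ᵇ k | n ≡ᵇ k
... | true  | _     = refl
... | false | true  = sym (shift0≡ren (shiftBy (suc k) C))
... | false | false = refl

subst≡sub : ∀ k C T → subst k C T ≡ sub (substVar k C) T
subst≡sub k C (tvar n) = refl
subst≡sub k C (tcon j) = refl
subst≡sub k C (A ⇒ B)  = cong₂ _⇒_ (subst≡sub k C A) (subst≡sub k C B)
subst≡sub k C (`∀ A)   = cong `∀ (trans (subst≡sub (suc k) C A) (sym (sub-cong e A)))
  where
    e : ∀ n → exts (substVar k C) n ≡ substVar (suc k) C n
    e zero    = refl
    e (suc n) = exts-substVar k C n

subst-shift : ∀ C T → subst 0 C (shift 0 T) ≡ T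
subst-shift C T = begin
  subst 0 C (shift 0 T)              ≡⟨ subst≡sub 0 C (shift 0 T) ⟩
  sub (substVar 0 C) (shift 0 T)     ≡⟨ cong (sub (substVar 0 C)) (shift0≡ren T) ⟩
  sub (substVar 0 C) (ren suc T)     ≡⟨ sub-ren (substVar 0 C) suc T ⟩
  sub tvar T                         ≡⟨ sub-id T ⟩
  T                                  ∎

shift-subst : ∀ k C T → shift 0 (subst k C T) ≡ subst (suc k) C (shift 0 T)
shift-subst k C T = begin
  shift 0 (subst k C T)                           ≡⟨ shift0≡ren (subst k C T) ⟩
  ren suc (subst k C T)                           ≡⟨ cong (ren suc) (subst≡sub k C T) ⟩
  ren suc (sub (substVar k C) T)                  ≡⟨ ren-sub suc (substVar k C) T ⟩
  sub (λ n → ren suc (substVar k C n)) T          ≡⟨ sub-cong (exts-substVar k C) T ⟩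
  sub (λ n → substVar (suc k) C (suc n)) T        ≡⟨ sym (sub-ren (substVar (suc k) C) suc T) ⟩
  sub (substVar (suc k) C) (ren suc T)            ≡⟨ cong (sub (substVar (suc k) C)) (sym (shift0≡ren T)) ⟩
  sub (substVar (suc k) C) (shift 0 T)            ≡⟨ sym (subst≡sub (suc k) C (shift 0 T)) ⟩
  subst (suc k) C (shift 0 T)                     ∎

sub-substVar0-shift : ∀ E T → sub (substVar 0 E) (shift 0 T) ≡ T
sub-substVar0-shift E T = trans (sym (subst≡sub 0 E (shift 0 T))) (subst-shift E T)

substVar-substVar : ∀ k C D n →
  sub (substVar k C) (substVar 0 D n) ≡ sub (substVar 0 (subst k C D)) (substVar (suc k) C n)
substVar-substVar k       C D zero          = sym (subst≡sub k C D)
substVar-substVar zero    C D (suc zero)    = sym (sub-substVar0-shift (subst 0 C D) C)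
substVar-substVar (suc k) C D (suc zero)    = refl
substVar-substVar zero    C D (suc (suc m)) = refl
substVar-substVar (suc k) C D (suc (suc m)) with m <ᵇ k | m ≡ᵇ k
... | true  | _     = refl
... | false | true  = sym (sub-substVar0-shift (subst (suc k) C D) (shiftBy (suc k) C))
... | false | false = refl

subst-subst : ∀ k C D A →
  subst k C (subst 0 D A) ≡ subst 0 (subst k C D) (subst (suc k) C A)
subst-subst k C D A = begin
  subst k C (subst 0 D A)
    ≡⟨ subst≡sub k C (subst 0 D A) ⟩
  sub (substVar k C) (subst 0 D A)
    ≡⟨ cong (sub (substVar k C)) (subst≡sub 0 D A) ⟩
  sub (substVar k C) (sub (substVar 0 D) A)
    ≡⟨ sub-sub (substVar k C) (substVar 0 D) A ⟩
  sub (λ n → sub (substVar k C) (substVar 0 D n)) A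
    ≡⟨ sub-cong (substVar-substVar k C D) A ⟩
  sub (λ n → sub (substVar 0 E) (substVar (suc k) C n)) A
    ≡⟨ sym (sub-sub (substVar 0 E) (substVar (suc k) C) A) ⟩
  sub (substVar 0 E) (sub (substVar (suc k) C) A)
    ≡⟨ cong (sub (substVar 0 E)) (sym (subst≡sub (suc k) C A)) ⟩
  sub (substVar 0 E) (subst (suc k) C A)
    ≡⟨ sym (subst≡sub 0 E (subst (suc k) C A)) ⟩
  subst 0 E (subst (suc k) C A) ∎
  where
    E : Type
    E = subst k C D

Occurs-ren : ∀ ρ n T → Occurs n T → Occurs (ρ n) (ren ρ T)
Occurs-ren ρ n (tvar m) refl     = refl
Occurs-ren ρ n (A ⇒ B) (inj₁ o) = inj₁ (Occurs-ren ρ n A o)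
Occurs-ren ρ n (A ⇒ B) (inj₂ o) = inj₂ (Occurs-ren ρ n B o)
Occurs-ren ρ n (`∀ A) o         = Occurs-ren (ext ρ) (suc n) A o

Occurs-ren⁻ : ∀ ρ n T → Occurs n (ren ρ T) → Σ ℕ (λ m → ρ m ≡ n)
Occurs-ren⁻ ρ n (tvar m) o        = m , o
Occurs-ren⁻ ρ n (A ⇒ B) (inj₁ o) = Occurs-ren⁻ ρ n A o
Occurs-ren⁻ ρ n (A ⇒ B) (inj₂ o) = Occurs-ren⁻ ρ n B o
Occurs-ren⁻ ρ n (`∀ A) o with Occurs-ren⁻ (ext ρ) (suc n) A o
... | zero  , ()
... | suc m , refl = m , refl

¬Occurs0-shift : ∀ T → Occurs 0 (shift 0 T) → ⊥
¬Occurs0-shift T o with Occurs-ren⁻ suc 0 T (transport (Occurs 0) (shift0≡ren T) o)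
... | _ , ()

Occurs-sub : ∀ σ m n T → Occurs m T → Occurs n (σ m) → Occurs n (sub σ T)
Occurs-sub σ m n (tvar j) refl o'     = o'
Occurs-sub σ m n (A ⇒ B) (inj₁ o) o' = inj₁ (Occurs-sub σ m n A o o')
Occurs-sub σ m n (A ⇒ B) (inj₂ o) o' = inj₂ (Occurs-sub σ m n B o o')
Occurs-sub σ m n (`∀ A) o o'         =
  Occurs-sub (exts σ) (suc m) (suc n) A o (Occurs-ren suc n (σ m) o')

Occurs0-subst : ∀ k C A → Occurs 0 A → Occurs 0 (subst (suc k) C A)
Occurs0-subst k C A o =
  transport (Occurs 0) (sym (subst≡sub (suc k) C A)) (Occurs-sub _ 0 0 A o refl)

WF-ren : ∀ ρ T → WF T → WF (ren ρ T)
WF-ren ρ (tvar n) w        = tt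
WF-ren ρ (tcon k) w        = tt
WF-ren ρ (A ⇒ B) (wa , wb) = WF-ren ρ A wa , WF-ren ρ B wb
WF-ren ρ (`∀ A) (wa , o)   = WF-ren (ext ρ) A wa , Occurs-ren (ext ρ) 0 A o

WF-sub : ∀ σ T → (∀ n → WF (σ n)) → WF T → WF (sub σ T)
WF-sub σ (tvar n) ws w        = ws n
WF-sub σ (tcon k) ws w        = tt
WF-sub σ (A ⇒ B) ws (wa , wb) = WF-sub σ A ws wa , WF-sub σ B ws wb
WF-sub σ (`∀ A) ws (wa , o)   = WF-sub (exts σ) A ws' wa , Occurs-sub (exts σ) 0 0 A o refl
  where
    ws' : ∀ n → WF (exts σ n)
    ws' zero    = tt
    ws' (suc n) = WF-ren suc (σ n) (ws n)

WF-shift : ∀ T → WF T → WF (shift 0 T)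
WF-shift T w = transport WF (sym (shift0≡ren T)) (WF-ren suc T w)

WF-shiftBy : ∀ k T → WF T → WF (shiftBy k T)
WF-shiftBy zero    T w = w
WF-shiftBy (suc k) T w = WF-shift _ (WF-shiftBy k T w)

WF-substVar : ∀ k C → WF C → ∀ n → WF (substVar k C n)
WF-substVar k C w n with n <ᵇ k
... | true  = tt
... | false with n ≡ᵇ k
...   | true  = WF-shiftBy k C w
...   | false = tt

WF-subst : ∀ k C T → WF C → WF T → WF (subst k C T)
WF-subst k C T wc wt =
  transport WF (sym (subst≡sub k C T)) (WF-sub _ T (WF-substVar k C wc) wt)

ren-fix : ∀ d ρ T → FreeBelow d T → (∀ n → n < d → ρ n ≡ n) → ren ρ T ≡ T
ren-fix d ρ (tvar n) f e        = cong tvar (e n f)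
ren-fix d ρ (tcon k) f e        = refl
ren-fix d ρ (A ⇒ B) (fa , fb) e = cong₂ _⇒_ (ren-fix d ρ A fa e) (ren-fix d ρ B fb e)
ren-fix d ρ (`∀ A) f e          = cong `∀ (ren-fix (suc d) (ext ρ) A f e')
  where
    e' : ∀ n → n < suc d → ext ρ n ≡ n
    e' zero    _       = refl
    e' (suc n) (s≤s l) = cong suc (e n l)

sub-fix : ∀ d σ T → FreeBelow d T → (∀ n → n < d → σ n ≡ tvar n) → sub σ T ≡ T
sub-fix d σ (tvar n) f e        = e n f
sub-fix d σ (tcon k) f e        = refl
sub-fix d σ (A ⇒ B) (fa , fb) e = cong₂ _⇒_ (sub-fix d σ A fa e) (sub-fix d σ B fb e)
sub-fix d σ (`∀ A) f e          = cong `∀ (sub-fix (suc d) (exts σ) A f e')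
  where
    e' : ∀ n → n < suc d → exts σ n ≡ tvar n
    e' zero    _       = refl
    e' (suc n) (s≤s l) = cong (ren suc) (e n l)

closed-shift : ∀ c T → Closed T → shift c T ≡ T
closed-shift c T cl = trans (shift≡ren c T) (ren-fix 0 _ T cl (λ _ ()))

closed-subst : ∀ k C T → Closed T → subst k C T ≡ T
closed-subst k C T cl = trans (subst≡sub k C T) (sub-fix 0 _ T cl (λ _ ()))

FreeBelow-mono : ∀ {d d'} T → d ≤ d' → FreeBelow d T → FreeBelow d' T
FreeBelow-mono (tvar n) l f        = ≤-trans f l
FreeBelow-mono (tcon k) l f        = tt
FreeBelow-mono (A ⇒ B) l (fa , fb) = FreeBelow-mono A l fa , FreeBelow-mono B l fb
FreeBelow-mono (`∀ A) l f          = FreeBelow-mono A (s≤s l) f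

Occurs-bound : ∀ {d n} T → FreeBelow d T → Occurs n T → n < d
Occurs-bound (tvar m) f refl     = f
Occurs-bound (A ⇒ B) (fa , _) (inj₁ o) = Occurs-bound A fa o
Occurs-bound (A ⇒ B) (_ , fb) (inj₂ o) = Occurs-bound B fb o
Occurs-bound {d} (`∀ A) f o with Occurs-bound {suc d} A f o
... | s≤s l = l

∋-map : ∀ {Γ x T} (f : Type → Type) → Γ ∋ x ∶ T → map f Γ ∋ x ∶ f T
∋-map f here      = here
∋-map f (there p) = there (∋-map f p)

map-subst-shift : ∀ C Γ → map (subst 0 C) (map (shift 0) Γ) ≡ Γ
map-subst-shift C []      = refl
map-subst-shift C (A ∷ Γ) = cong₂ _∷_ (subst-shift C A) (map-subst-shift C Γ)

map-shift-subst : ∀ k C Γ →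
  map (subst (suc k) C) (map (shift 0) Γ) ≡ map (shift 0) (map (subst k C) Γ)
map-shift-subst k C []      = refl
map-shift-subst k C (A ∷ Γ) = cong₂ _∷_ (sym (shift-subst k C A)) (map-shift-subst k C Γ)

⊢-subst : ∀ {Γ t T} k C → WF C → Γ ⊢ t ∶ T → map (subst k C) Γ ⊢ t ∶ subst k C T
⊢-subst k C w (ax p)              = ax (∋-map (subst k C) p)
⊢-subst k C w (→i {A = A} wa d)   = →i (WF-subst k C A w wa) (⊢-subst k C w d)
⊢-subst k C w (→e d e)            = →e (⊢-subst k C w d) (⊢-subst k C w e)
⊢-subst {Γ} k C w (∀i {A = A} o d) =
  ∀i (Occurs0-subst k C A o)
     (transport (_⊢ _ ∶ _) (map-shift-subst k C Γ) (⊢-subst (suc k) C w d))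
⊢-subst {Γ} k C w (∀e {A = A} D wd d) =
  transport (map (subst k C) Γ ⊢ _ ∶_) (sym (subst-subst k C D A))
    (∀e (subst k C D) (WF-subst k C D w wd) (⊢-subst k C w d))

data LamTyping : Ctx → Term → Type → Set where
  arr : ∀ {Γ t A B} → WF A → (A ∷ Γ) ⊢ t ∶ B → LamTyping Γ t (A ⇒ B)
  all : ∀ {Γ t A} → Occurs 0 A → LamTyping (map (shift 0) Γ) t A → LamTyping Γ t (`∀ A)

LamTyping-subst : ∀ {Γ t T} k C → WF C → LamTyping Γ t T →
  LamTyping (map (subst k C) Γ) t (subst k C T)
LamTyping-subst k C w (arr {A = A} wa d) = arr (WF-subst k C A w wa) (⊢-subst k C w d)
LamTyping-subst {Γ} k C w (all {A = A} o l) =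
  all (Occurs0-subst k C A o)
      (transport (λ Δ → LamTyping Δ _ _) (map-shift-subst k C Γ) (LamTyping-subst (suc k) C w l))

-- Inversion for abstractions: a ∀-elimination applied to a ∀-introduction
-- is absorbed by substituting into the canonical typing.
lam-inversion : ∀ {Γ t T} → Γ ⊢ lam t ∶ T → LamTyping Γ t T
lam-inversion (→i w d) = arr w d
lam-inversion (∀i o d) = all o (lam-inversion d)
lam-inversion {Γ} (∀e C w d) with lam-inversion d
... | all o l = transport (λ Δ → LamTyping Δ _ _) (map-subst-shift C Γ) (LamTyping-subst 0 C w l)

infixl 20 _▷_
data Args : Set where
  ε   : Args
  _▷_ : Args → Term → Args

apps : Term → Args → Term
apps h ε        = h
apps h (es ▷ e) = app (apps h es) e

len : Args → ℕ
len ε        = 0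
len (es ▷ e) = suc (len es)

data NormalArgs : Args → Set where
  ε   : NormalArgs ε
  _▷_ : ∀ {es e} → NormalArgs es → Normal e → NormalArgs (es ▷ e)

neutral-spine : ∀ {s} → Neutral s →
  Σ ℕ λ h → Σ Args λ es → (s ≡ apps (var h) es) × NormalArgs es
neutral-spine (var n) = n , ε , refl , ε
neutral-spine (app n u) with neutral-spine n
... | h , es , refl , na = h , es ▷ _ , refl , na ▷ u

arrows : List Type → Type → Type
arrows []       R = R
arrows (P ∷ Ps) R = P ⇒ arrows Ps R

Atom : Type → Set
Atom (tvar _) = ⊤
Atom (tcon _) = ⊤
Atom (_ ⇒ _)  = ⊥
Atom (`∀ _)   = ⊥

-- ArgTyping Γ es Ps Qs: the arguments es consume the premises Ps up to the rest Qs.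
data ArgTyping (Γ : Ctx) : Args → List Type → List Type → Set where
  nil  : ∀ {Ps} → ArgTyping Γ ε Ps Ps
  snoc : ∀ {es e Ps P Qs} → ArgTyping Γ es Ps (P ∷ Qs) → Γ ⊢ e ∶ P →
         ArgTyping Γ (es ▷ e) Ps Qs

ArgTyping-split : ∀ {Γ es Ps Qs} → ArgTyping Γ es Ps Qs →
  Σ (List Type) λ Ps₁ → (Ps ≡ Ps₁ ++ Qs) × (length Ps₁ ≡ len es)
ArgTyping-split nil = [] , refl , refl
ArgTyping-split (snoc {P = P} {Qs = Qs} t d) with ArgTyping-split t
... | Ps₁ , refl , l =
  Ps₁ ++ P ∷ [] , sym (++-assoc Ps₁ (P ∷ []) Qs) ,
  trans (trans (length-++ Ps₁) (+-comm (length Ps₁) 1)) (cong suc l)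

∋-unique : ∀ {Γ x A B} → Γ ∋ x ∶ A → Γ ∋ x ∶ B → A ≡ B
∋-unique here      here      = refl
∋-unique (there p) (there q) = ∋-unique p q

∋-map⁻ : ∀ {Γ h T} (f : Type → Type) → map f Γ ∋ h ∶ T → Σ Type (Γ ∋ h ∶_)
∋-map⁻ {A ∷ Γ} f here = A , here
∋-map⁻ {A ∷ Γ} f (there p) with ∋-map⁻ f p
... | T , q = T , there q

shift-arrows : ∀ Ps R → shift 0 (arrows Ps R) ≡ arrows (map (shift 0) Ps) (shift 0 R)
shift-arrows []       R = refl
shift-arrows (P ∷ Ps) R = cong (shift 0 P ⇒_) (shift-arrows Ps R)

Atom-shift : ∀ R → Atom R → Atom (shift 0 R)
Atom-shift (tvar n) a = tt
Atom-shift (tcon k) a = tt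

Occurs0-arrows : ∀ Ps₁ Qs R → Occurs 0 (arrows Qs R) → Occurs 0 (arrows (Ps₁ ++ Qs) R)
Occurs0-arrows []        Qs R o = o
Occurs0-arrows (P ∷ Ps₁) Qs R o = inj₂ (Occurs0-arrows Ps₁ Qs R o)

-- A ∀-introduction cannot occur (the new variable would have to occur in a type
-- shifted past it), nor can a ∀-elimination (the type is not a ∀-type).
spine : ∀ {Γ t U} → Γ ⊢ t ∶ U → ∀ {h Ps R} es → Γ ∋ h ∶ arrows Ps R → Atom R →
  t ≡ apps (var h) es → Σ (List Type) λ Qs → (U ≡ arrows Qs R) × ArgTyping Γ es Ps Qs
spine (ax p)      ε        q a refl = _ , ∋-unique p q , nil
spine (→e d d')   (es ▷ e) q a refl with spine d es q a refl
... | []     , eq   , _  = ⊥-elim (transport Atom (sym eq) a)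
... | Q ∷ Qs , refl , ty = Qs , refl , snoc ty d'
spine (∀i {A = A} o d) {Ps = Ps} {R} es q a eq
  with spine d es (transport (_ ∋ _ ∶_) (shift-arrows Ps R) (∋-map (shift 0) q))
                  (Atom-shift R a) eq
... | Qs , refl , ty with ArgTyping-split ty
... | Ps₁ , split , _ =
  ⊥-elim (¬Occurs0-shift (arrows Ps R)
    (transport (Occurs 0)
      (sym (trans (shift-arrows Ps R) (cong (λ Xs → arrows Xs (shift 0 R)) split)))
      (Occurs0-arrows Ps₁ Qs (shift 0 R) o)))
spine (∀e C w d) es q a eq with spine d es q a eq
... | []    , eq' , _ = ⊥-elim (transport Atom (sym eq') a)
... | _ ∷ _ , ()  , _

head-typed : ∀ {Γ t U} → Γ ⊢ t ∶ U → ∀ {h} es → t ≡ apps (var h) es → Σ Type (Γ ∋ h ∶_)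
head-typed (ax p)     ε        refl = _ , p
head-typed (→e d d')  (es ▷ e) refl = head-typed d es refl
head-typed (∀i o d)   es eq with head-typed d es eq
... | T , p = ∋-map⁻ (shift 0) p
head-typed (∀e C w d) es eq = head-typed d es eq

atom-head : ∀ {Γ h es U m} → Γ ⊢ apps (var h) es ∶ U → Γ ∋ h ∶ tvar m →
  (es ≡ ε) × (U ≡ tvar m)
atom-head {es = es} {m = m} d p with spine d {Ps = []} {R = tvar m} es p tt refl
... | Qs , eU , ty with ArgTyping-split ty
atom-head {es = ε} d p | Qs , eU , ty | [] , refl , _ = refl , eU

¬lam-tvar : ∀ {Γ s m} → Γ ⊢ lam s ∶ tvar m → ⊥
¬lam-tvar d with lam-inversion d
... | ()

size : Term → ℕ
size (var _)   = 0
size (lam t)   = suc (size t)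
size (app t u) = suc (size t + size u)

FreeInArgs : ℕ → Args → Set
FreeInArgs k ε        = ⊥
FreeInArgs k (es ▷ e) = FreeInArgs k es ⊎ FreeIn k e

free-in-spine : ∀ {k h} es → FreeIn k (apps (var h) es) → h ≡ k ⊎ FreeInArgs k es
free-in-spine ε        f        = inj₁ f
free-in-spine (es ▷ e) (inj₁ f) = Sum.map₂ inj₁ (free-in-spine es f)
free-in-spine (es ▷ e) (inj₂ f) = inj₂ (inj₂ f)

argument-with-x : ∀ {Γ k h es Ps Qs} {Pr : Type → Set} → All Pr Ps → ArgTyping Γ es Ps Qs →
  NormalArgs es → FreeInArgs k es →
  Σ Term λ e → Σ Type λ P → Pr P × Normal e × (Γ ⊢ e ∶ P) × FreeIn k e ×
    (size e < size (apps (var h) es))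
argument-with-x {h = h} prs (snoc {e = e'} ty _) (na ▷ _) (inj₁ fa)
  with argument-with-x {h = h} prs ty na fa
... | e , P , pr , nf , de , fe , sz =
  e , P , pr , nf , de , fe , <-trans sz (s≤s (m≤m+n _ (size e')))
argument-with-x {h = h} prs (snoc {es = es} {e = e} ty de) (_ ▷ nf) (inj₂ fe)
  with ArgTyping-split ty
... | Ps₁ , refl , _ with All.++⁻ʳ Ps₁ prs
...   | pr ∷ _ = e , _ , pr , nf , de , fe , s≤s (m≤n+m (size e) (size (apps (var h) es)))

∋-++⁻ : ∀ Γ {X i T} → (Γ ++ X ∷ []) ∋ i ∶ T → (Γ ∋ i ∶ T) ⊎ (T ≡ X)
∋-++⁻ []      here      = inj₂ refl
∋-++⁻ (A ∷ Γ) here      = inj₁ here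
∋-++⁻ (A ∷ Γ) (there p) = Sum.map₁ there (∋-++⁻ Γ p)

All-∋ : ∀ {Pr : Type → Set} {Γ i T} → All Pr Γ → Γ ∋ i ∶ T → Pr T
All-∋ (pr ∷ _)  here      = pr
All-∋ (_ ∷ prs) (there p) = All-∋ prs p

-- λy₁ … λyₘ. x, the normal inhabitant of P₁ ⇒ … ⇒ Pₘ ⇒ X built from x : X.
lams : ℕ → Term → Term
lams zero    t = t
lams (suc m) t = lam (lams m t)

lams-typed : ∀ Ps {Γ q n} → All WF Ps → Γ ∋ q ∶ tvar n →
  Γ ⊢ lams (length Ps) (var (q + length Ps)) ∶ arrows Ps (tvar n)
lams-typed []       {q = q} []       p rewrite +-identityʳ q = ax p
lams-typed (P ∷ Ps) {q = q} (w ∷ ws) p rewrite +-suc q (length Ps) =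
  →i w (lams-typed Ps ws (there p))

lams-free : ∀ r d → FreeIn d (lams r (var (d + r)))
lams-free zero    d = +-identityʳ d
lams-free (suc r) d rewrite +-suc d r = lams-free r (suc d)

lams-normal : ∀ r i → Normal (lams r (var i))
lams-normal zero    i = ne (var i)
lams-normal (suc r) i = lam (lams-normal r i)

∋-last : ∀ Δ {X} → (Δ ++ X ∷ []) ∋ length Δ ∶ X
∋-last []      = here
∋-last (_ ∷ Δ) = there (∋-last Δ)

data Hyps (n : ℕ) : List ℕ → Ctx → Set where
  []  : Hyps n [] []
  hyp : ∀ {m ar H Hs} (Ps : List Type) → H ≡ arrows Ps (tvar n) → length Ps ≡ m →
        All WF Ps → Hyps n ar Hs → Hyps n (m ∷ ar) (H ∷ Hs)

Hyps-length : ∀ {n ar Hs} → Hyps n ar Hs → length Hs ≡ length ar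
Hyps-length []                = refl
Hyps-length (hyp _ _ _ _ hs) = cong suc (Hyps-length hs)

Hyps-shift : ∀ {n ar Hs} → Hyps n ar Hs → Hyps (suc n) ar (map (shift 0) Hs)
Hyps-shift [] = []
Hyps-shift {n} (hyp Ps refl l w hs) =
  hyp (map (shift 0) Ps) (shift-arrows Ps (tvar n)) (trans (length-map (shift 0) Ps) l)
      (All.gmap⁺ (λ {P} → WF-shift P) w) (Hyps-shift hs)

lookupMaybe : List ℕ → ℕ → Maybe ℕ
lookupMaybe []       _       = nothing
lookupMaybe (m ∷ _)  zero    = just m
lookupMaybe (_ ∷ ms) (suc i) = lookupMaybe ms i

beyond-hyps : ∀ {n ar Hs i T} → Hyps n ar Hs → (Hs ++ tvar n ∷ []) ∋ i ∶ T →
  lookupMaybe ar i ≡ nothing → (i ≡ length ar) × (T ≡ tvar n)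
beyond-hyps []                    here      _ = refl , refl
beyond-hyps (hyp _ _ _ _ hs) (there p) e with beyond-hyps hs p e
... | refl , refl = refl , refl

hyp-lookup : ∀ {n ar Hs i m} → Hyps n ar Hs → lookupMaybe ar i ≡ just m →
  Σ (List Type) λ Ps → ((Hs ++ tvar n ∷ []) ∋ i ∶ arrows Ps (tvar n)) × (length Ps ≡ m) × All WF Ps
hyp-lookup {i = zero}  (hyp Ps refl l w _) refl = Ps , here , l , w
hyp-lookup {i = suc i} (hyp _ _ _ _ hs) e with hyp-lookup hs e
... | Ps , p , l , w = Ps , there p , l , w

map-shift-context : ∀ Δ Hs n → map (shift 0) (Δ ++ Hs ++ tvar n ∷ []) ≡
  map (shift 0) Δ ++ map (shift 0) Hs ++ tvar (suc n) ∷ []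
map-shift-context Δ Hs n =
  trans (map-++ (shift 0) Δ (Hs ++ tvar n ∷ []))
        (cong (map (shift 0) Δ ++_) (map-++ (shift 0) Hs (tvar n ∷ [])))

-- Elimination of the hypotheses with arities ar from a context Δ ++ Hs ++ [x : X]
-- (Δ the binders passed so far, d = length Δ).  A hypothesis applied to j of its m
-- premises becomes λy_{j+1} … λyₘ. x; other variables are renumbered.
module Elimination (ar : List ℕ) where

  nHyps : ℕ
  nHyps = length ar

  hypArity : ℕ → ℕ → Maybe ℕ
  hypArity zero    i       = lookupMaybe ar i
  hypArity (suc d) zero    = nothing
  hypArity (suc d) (suc i) = hypArity d i

  reindex : ℕ → ℕ → ℕ
  reindex zero    i       = i ∸ nHyps
  reindex (suc d) zero    = zero
  reindex (suc d) (suc i) = suc (reindex d i)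

  applyArg : Maybe ℕ → Maybe ℕ
  applyArg (just (suc r)) = just r
  applyArg _              = nothing

  remaining : ℕ → Term → Maybe ℕ
  remaining d (var i)   = hypArity d i
  remaining d (lam t)   = nothing
  remaining d (app t u) = applyArg (remaining d t)

  mutual
    elim : ℕ → Term → Term
    elim d u = elimWith (remaining d u) d u

    elimWith : Maybe ℕ → ℕ → Term → Term
    elimWith (just r) d u         = lams r (var (d + r))
    elimWith nothing  d (var i)   = var (reindex d i)
    elimWith nothing  d (lam t)   = lam (elim (suc d) t)
    elimWith nothing  d (app t u) = app (elim d t) (elim d u)

  reindex-x : ∀ d → reindex d (d + nHyps) ≡ d
  reindex-x zero    = n∸n≡0 nHyps
  reindex-x (suc d) = cong suc (reindex-x d)

  mutual
    elim-free : ∀ d u → FreeIn (d + nHyps) u → FreeIn d (elim d u)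
    elim-free d u = elimWith-free (remaining d u) d u

    elimWith-free : ∀ m d u → FreeIn (d + nHyps) u → FreeIn d (elimWith m d u)
    elimWith-free (just r) d u         f        = lams-free r d
    elimWith-free nothing  d (var i)   refl     = reindex-x d
    elimWith-free nothing  d (lam t)   f        = elim-free (suc d) t f
    elimWith-free nothing  d (app t u) (inj₁ f) = inj₁ (elim-free d t f)
    elimWith-free nothing  d (app t u) (inj₂ f) = inj₂ (elim-free d u f)

  -- Normal forms are preserved: a neutral term that is not a partially applied
  -- hypothesis has a neutral image, since its head is either kept or was a
  -- hypothesis applied to all of its premises (and then became x).

  mutual
    elim-neutral : ∀ d {u} → Neutral u → remaining d u ≡ nothing → Neutral (elimWith nothing d u)
    elim-neutral d (var i)       e = var _
    elim-neutral d (app {t} n v) e = app (head (remaining d t) refl e) (elim-normal d v)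
      where
        head : ∀ m → remaining d t ≡ m → applyArg m ≡ nothing → Neutral (elim d t)
        head nothing        e₁ _ rewrite e₁ = elim-neutral d n e₁
        head (just zero)    e₁ _ rewrite e₁ = var _
        head (just (suc r)) e₁ ()

    elim-normal : ∀ d {u} → Normal u → Normal (elim d u)
    elim-normal d (lam n) = lam (elim-normal (suc d) n)
    elim-normal d {u} (ne n) with remaining d u in e
    ... | just r  = lams-normal r _
    ... | nothing = ne (elim-neutral d n e)

  remaining-sound : ∀ d u {r} → remaining d u ≡ just r →
    Σ ℕ λ i → Σ Args λ es → Σ ℕ λ m →
      (u ≡ apps (var i) es) × (hypArity d i ≡ just m) × (m ≡ len es + r)
  remaining-sound d (var i)   e = i , ε , _ , refl , e , refl
  remaining-sound d (app t u) {r} e = go (remaining d t) refl e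
    where
      go : ∀ m → remaining d t ≡ m → applyArg m ≡ just r →
        Σ ℕ λ i → Σ Args λ es → Σ ℕ λ m →
          (app t u ≡ apps (var i) es) × (hypArity d i ≡ just m) × (m ≡ len es + r)
      go nothing         _  ()
      go (just zero)     _  ()
      go (just (suc r')) e₁ refl with remaining-sound d t e₁
      ... | i , es , m , refl , h , m≡ = i , es ▷ u , m , refl , h , trans m≡ (+-suc (len es) r')

  var-kept : ∀ Δ {n Hs i T} → Hyps n ar Hs → (Δ ++ Hs ++ tvar n ∷ []) ∋ i ∶ T →
    hypArity (length Δ) i ≡ nothing → (Δ ++ tvar n ∷ []) ∋ reindex (length Δ) i ∶ T
  var-kept [] hs p e with beyond-hyps hs p e
  ... | refl , refl rewrite n∸n≡0 nHyps = here
  var-kept (D ∷ Δ) hs here      e = here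
  var-kept (D ∷ Δ) hs (there p) e = there (var-kept Δ hs p e)

  hyp-typed : ∀ Δ {n Hs i m} → Hyps n ar Hs → hypArity (length Δ) i ≡ just m →
    Σ (List Type) λ Ps →
      ((Δ ++ Hs ++ tvar n ∷ []) ∋ i ∶ arrows Ps (tvar n)) × (length Ps ≡ m) × All WF Ps
  hyp-typed []      hs e = hyp-lookup hs e
  hyp-typed (D ∷ Δ) {i = suc i} hs e with hyp-typed Δ hs e
  ... | Ps , p , l , w = Ps , there p , l , w

  -- A hypothesis applied to j of its m premises has type Pⱼ₊₁ ⇒ … ⇒ Pₘ ⇒ X,
  -- which is also the type of its image λy_{j+1} … λyₘ. x.
  elim-saturated : ∀ {Γ u T} Δ {n Hs r} → Γ ⊢ u ∶ T → Γ ≡ Δ ++ Hs ++ tvar n ∷ [] →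
    Hyps n ar Hs → remaining (length Δ) u ≡ just r →
    (Δ ++ tvar n ∷ []) ⊢ lams r (var (length Δ + r)) ∶ T
  elim-saturated {u = u} Δ {n} {r = r} D refl hs e with remaining-sound (length Δ) u e
  ... | i , es , m , refl , ha , m≡ with hyp-typed Δ hs ha
  ... | Ps , p , lenPs , wf with spine D {R = tvar n} es p tt refl
  ... | Qs , refl , ty with ArgTyping-split ty
  ... | Ps₁ , refl , lenPs₁ =
    transport (λ z → (Δ ++ tvar n ∷ []) ⊢ lams z (var (length Δ + z)) ∶ arrows Qs (tvar n))
      lenQs (lams-typed Qs (All.++⁻ʳ Ps₁ wf) (∋-last Δ))
    where
      lenQs : length Qs ≡ r
      lenQs = +-cancelˡ-≡ (len es) (length Qs) r (begin
        len es + length Qs       ≡⟨ cong (_+ length Qs) (sym lenPs₁) ⟩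
        length Ps₁ + length Qs   ≡⟨ sym (length-++ Ps₁) ⟩
        length (Ps₁ ++ Qs)       ≡⟨ lenPs ⟩
        m                        ≡⟨ m≡ ⟩
        len es + r               ∎)

  elim-typed : ∀ {Γ u T} → Γ ⊢ u ∶ T → ∀ Δ {n Hs} → Γ ≡ Δ ++ Hs ++ tvar n ∷ [] →
    Hyps n ar Hs → (Δ ++ tvar n ∷ []) ⊢ elim (length Δ) u ∶ T
  elim-typed {T = T} (ax {x = i} p) Δ {n} refl hs = headVar (hypArity (length Δ) i) refl
    where
      headVar : ∀ m → hypArity (length Δ) i ≡ m →
        (Δ ++ tvar n ∷ []) ⊢ elimWith m (length Δ) (var i) ∶ T
      headVar (just r) e = elim-saturated Δ (ax p) refl hs e
      headVar nothing  e = ax (var-kept Δ hs p e)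
  elim-typed (→i {A = A} w D) Δ refl hs = →i w (elim-typed D (A ∷ Δ) refl hs)
  elim-typed {T = T} (→e {t = t} {u = u} D₁ D₂) Δ {n} refl hs =
    application (remaining (length Δ) (app t u)) refl
    where
      application : ∀ m → remaining (length Δ) (app t u) ≡ m →
        (Δ ++ tvar n ∷ []) ⊢ elimWith m (length Δ) (app t u) ∶ T
      application (just r) e = elim-saturated Δ (→e D₁ D₂) refl hs e
      application nothing  _ = →e (elim-typed D₁ Δ refl hs) (elim-typed D₂ Δ refl hs)
  elim-typed (∀i {t = u} {A = A} o D) Δ {n} {Hs} refl hs =
    ∀i o (transport₂ (λ Θ d → Θ ⊢ elim d u ∶ A)
            (sym (map-++ (shift 0) Δ (tvar n ∷ []))) (length-map (shift 0) Δ)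
            (elim-typed D (map (shift 0) Δ) (map-shift-context Δ Hs n) (Hyps-shift hs)))
  elim-typed (∀e C w D) Δ refl hs = ∀e C w (elim-typed D Δ refl hs)

output-omits : ∀ {A e} → IsOutput A → Normal e → (tvar 0 ∷ []) ⊢ e ∶ A → ¬ FreeIn 0 e
output-omits {A} {e} (cA , _ , omits) nf d =
  omits e nf (∀i (inj₁ refl) (→i tt (transport ((tvar 0 ∷ []) ⊢ e ∶_) (sym (closed-shift 0 A cA)) d)))

-- The connectives are impredicative encodings ∀Y(H₁ ⇒ … ⇒ Hₙ ⇒ Y) whose
-- constructor types Hᵢ = P₁ ⇒ … ⇒ Pₘ ⇒ Y have premises Y or closed output types.
data Premise : Type → Set where
  Y      : Premise (tvar 0)
  output : ∀ {A} → IsOutput A → Premise A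

data IsConstructor : Type → Set where
  ctor : ∀ {Ps} → All Premise Ps → IsConstructor (arrows Ps (tvar 0))

Premise-WF : ∀ {P} → Premise P → WF P
Premise-WF Y                  = tt
Premise-WF (output (_ , w , _)) = w

¬Premise-into-Y : ∀ {P Q} → Occurs 0 Q → ¬ Premise (P ⇒ Q)
¬Premise-into-Y {Q = Q} o (output ((_ , cQ) , _)) with Occurs-bound Q cQ o
... | ()

subst-arrows : ∀ k C Ps R → subst k C (arrows Ps R) ≡ arrows (map (subst k C) Ps) (subst k C R)
subst-arrows k C []       R = refl
subst-arrows k C (P ∷ Ps) R = cong (subst k C P ⇒_) (subst-arrows k C Ps R)

-- Identifying Y with X turns constructors into hypotheses with target X.
collapse : ∀ {Γ} → All IsConstructor Γ → Σ (List ℕ) λ ar → Hyps 0 ar (map (subst 0 (tvar 0)) Γ)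
collapse [] = [] , []
collapse (ctor {Ps} prems ∷ cs) with collapse cs
... | ar , hs =
  _ , hyp (map (subst 0 (tvar 0)) Ps) (subst-arrows 0 (tvar 0) Ps (tvar 0)) refl
          (All.gmap⁺ (λ {P} pr → WF-subst 0 (tvar 0) P tt (Premise-WF pr)) prems) hs

-- An argument of output type in a context of constructors and x : X does not
-- mention x: collapse Y to X and eliminate the constructors, keeping x.
argument-omits : ∀ {Γ A e} → All IsConstructor Γ → IsOutput A → Normal e →
  (Γ ++ tvar 1 ∷ []) ⊢ e ∶ A → ¬ FreeIn (length Γ) e
argument-omits {Γ} {A} {e} cs oA@(cA , _ , _) nf d fr with collapse cs
... | ar , hs = output-omits oA (elim-normal 0 nf) typed free
  where
    open Elimination ar

    typed : (tvar 0 ∷ []) ⊢ elim 0 e ∶ A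
    typed = transport ((tvar 0 ∷ []) ⊢ elim 0 e ∶_) (closed-subst 0 (tvar 0) A cA)
      (elim-typed (⊢-subst 0 (tvar 0) tt d) [] (map-++ (subst 0 (tvar 0)) Γ (tvar 1 ∷ [])) hs)

    free : FreeIn 0 (elim 0 e)
    free = elim-free 0 e
      (transport (λ i → FreeIn i e) (trans (sym (length-map _ Γ)) (Hyps-length hs)) fr)

neutral-type : ∀ {Γ m s U} → All IsConstructor Γ → Neutral s → (Γ ++ tvar m ∷ []) ⊢ s ∶ U →
  (U ≡ tvar m) ⊎ (Σ (List Type) λ Qs → (U ≡ arrows Qs (tvar 0)) × All Premise Qs)
neutral-type {Γ} cs n d with neutral-spine n
... | h , es , refl , _ with head-typed d es refl
... | T , p with ∋-++⁻ Γ p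
... | inj₂ refl = inj₁ (proj₂ (atom-head d p))
... | inj₁ q with All-∋ cs q
...   | ctor {Ps} prems with spine d {Ps = Ps} es p tt refl
...     | Qs , eU , ty with ArgTyping-split ty
...       | Ps₁ , refl , _ = inj₂ (Qs , eU , All.++⁻ʳ Ps₁ prems)

spine-of-Y : ∀ {Γ h es} → All IsConstructor Γ → (Γ ++ tvar 1 ∷ []) ⊢ apps (var h) es ∶ tvar 0 →
  Σ (List Type) λ Ps → All Premise Ps × ArgTyping (Γ ++ tvar 1 ∷ []) es Ps []
spine-of-Y {Γ} {es = es} cs d with head-typed d es refl
... | T , p with ∋-++⁻ Γ p
... | inj₂ refl with atom-head d p
...   | _ , ()
spine-of-Y {Γ} {es = es} cs d | T , p | inj₁ q with All-∋ cs q
... | ctor {Ps} prems with spine d {Ps = Ps} es p tt refl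
...   | [] , _ , ty = Ps , prems , ty
...   | _ ∷ _ , () , _

-- Its head is a constructor, so x occurs in an
-- argument, whose type is Y (induction on size) or an output type.
constructors-omit-x : ∀ fuel {Γ s} → All IsConstructor Γ → size s < fuel → Normal s →
  (Γ ++ tvar 1 ∷ []) ⊢ s ∶ tvar 0 → ¬ FreeIn (length Γ) s
constructors-omit-x (suc fuel) cs lt (lam _) d _ = ¬lam-tvar d
constructors-omit-x (suc fuel) {Γ} cs lt (ne n) d fr with neutral-spine n
... | h , es , refl , na with spine-of-Y cs d | free-in-spine es fr
...   | _ | inj₁ refl with atom-head d (∋-last Γ)
...     | _ , ()
constructors-omit-x (suc fuel) {Γ} cs lt (ne n) d fr | h , es , refl , na
      | Ps , prems , ty | inj₂ fa with argument-with-x {h = h} prems ty na fa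
... | e , _ , Y        , nf , de , fe , sz = constructors-omit-x fuel cs (<-≤-trans sz (s≤s⁻¹ lt)) nf de fe
... | e , _ , output oA , nf , de , fe , _ = argument-omits cs oA nf de fe

lam-body : ∀ {t T} → [] ⊢ lam t ∶ `∀ (tvar 0 ⇒ T) → (tvar 0 ∷ []) ⊢ t ∶ T
lam-body D with lam-inversion D
... | all _ (arr _ d) = d

forall-body : ∀ {t P Q} → Normal t → (tvar 0 ∷ []) ⊢ t ∶ `∀ (P ⇒ Q) →
  Σ Term λ s → (t ≡ lam s) × Normal s × ((P ∷ tvar 1 ∷ []) ⊢ s ∶ Q)
forall-body (lam nf) d with lam-inversion d
... | all _ (arr _ d') = _ , refl , nf , d'
forall-body (ne n) d with neutral-type {Γ = []} [] n d
... | inj₁ ()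
... | inj₂ ([]    , () , _)
... | inj₂ (_ ∷ _ , () , _)

arrow-body : ∀ {Γ m t P Q} → All IsConstructor Γ → ¬ Premise P → Normal t →
  (Γ ++ tvar m ∷ []) ⊢ t ∶ P ⇒ Q →
  Σ Term λ s → (t ≡ lam s) × Normal s × ((P ∷ Γ ++ tvar m ∷ []) ⊢ s ∶ Q)
arrow-body cs np (lam nf) d with lam-inversion d
... | arr _ d' = _ , refl , nf , d'
arrow-body cs np (ne n) d with neutral-type cs n d
... | inj₁ ()
... | inj₂ ([]    , () , _)
... | inj₂ (_ ∷ _ , refl , pr ∷ _) = ⊥-elim (np pr)

shift-closed-FreeBelow : ∀ A → Closed A → FreeBelow 1 (shift 0 A)
shift-closed-FreeBelow A c =
  transport (FreeBelow 1) (sym (closed-shift 0 A c)) (FreeBelow-mono A z≤n c)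

shift-shift-closed : ∀ A → Closed A → shift 1 (shift 0 A) ≡ A
shift-shift-closed A c = trans (cong (shift 1) (closed-shift 0 A c)) (closed-shift 1 A c)

∧-output : ∀ {A B} → IsOutput A → IsOutput B → IsOutput (A ∧ B)
∧-output {A} {B} oA@(cA , wA , _) oB@(cB , wB , _) =
  ((shift-closed-FreeBelow A cA , shift-closed-FreeBelow B cB , s≤s z≤n) , s≤s z≤n) ,
  (((WF-shift A wA , WF-shift B wB , tt) , tt) , inj₂ refl) ,
  omits
  where
    shape : shift 0 (A ∧ B) ≡ `∀ ((A ⇒ (B ⇒ tvar 0)) ⇒ tvar 0)
    shape = cong₂ (λ A' B' → `∀ ((A' ⇒ (B' ⇒ tvar 0)) ⇒ tvar 0))
                  (shift-shift-closed A cA) (shift-shift-closed B cB)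

    omits : ∀ t → Normal t → [] ⊢ lam t ∶ `∀ (tvar 0 ⇒ shift 0 (A ∧ B)) → ¬ FreeIn 0 t
    omits t nt D with forall-body nt (transport ((tvar 0 ∷ []) ⊢ t ∶_) shape (lam-body D))
    ... | s , refl , ns , ds =
      constructors-omit-x (suc (size s)) (ctor (output oA ∷ output oB ∷ []) ∷ []) ≤-refl ns ds

∨-output : ∀ {A B} → IsOutput A → IsOutput B → IsOutput (A ∨ B)
∨-output {A} {B} oA@(cA , wA , _) oB@(cB , wB , _) =
  ((shift-closed-FreeBelow A cA , s≤s z≤n) , (shift-closed-FreeBelow B cB , s≤s z≤n) , s≤s z≤n) ,
  (((WF-shift A wA , tt) , (WF-shift B wB , tt) , tt) , inj₂ (inj₂ refl)) ,
  omits
  where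
    shape : shift 0 (A ∨ B) ≡ `∀ ((A ⇒ tvar 0) ⇒ ((B ⇒ tvar 0) ⇒ tvar 0))
    shape = cong₂ (λ A' B' → `∀ ((A' ⇒ tvar 0) ⇒ ((B' ⇒ tvar 0) ⇒ tvar 0)))
                  (shift-shift-closed A cA) (shift-shift-closed B cB)

    omits : ∀ t → Normal t → [] ⊢ lam t ∶ `∀ (tvar 0 ⇒ shift 0 (A ∨ B)) → ¬ FreeIn 0 t
    omits t nt D with forall-body nt (transport ((tvar 0 ∷ []) ⊢ t ∶_) shape (lam-body D))
    ... | s , refl , ns , ds
      with arrow-body (ctor (output oA ∷ []) ∷ []) (¬Premise-into-Y refl) ns ds
    ...   | s' , refl , ns' , ds' =
      constructors-omit-x (suc (size s')) (ctor (output oB ∷ []) ∷ ctor (output oA ∷ []) ∷ [])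
        ≤-refl ns' ds'

L-output : ∀ {A} → IsOutput A → IsOutput (L A)
L-output {A} oA@(cA , wA , _) =
  (s≤s z≤n , (shift-closed-FreeBelow A cA , s≤s z≤n , s≤s z≤n) , s≤s z≤n) ,
  ((tt , (WF-shift A wA , tt , tt) , tt) , inj₁ refl) ,
  omits
  where
    shape : shift 0 (L A) ≡ `∀ (tvar 0 ⇒ ((A ⇒ (tvar 0 ⇒ tvar 0)) ⇒ tvar 0))
    shape = cong (λ A' → `∀ (tvar 0 ⇒ ((A' ⇒ (tvar 0 ⇒ tvar 0)) ⇒ tvar 0))) (shift-shift-closed A cA)

    omits : ∀ t → Normal t → [] ⊢ lam t ∶ `∀ (tvar 0 ⇒ shift 0 (L A)) → ¬ FreeIn 0 t
    omits t nt D with forall-body nt (transport ((tvar 0 ∷ []) ⊢ t ∶_) shape (lam-body D))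
    ... | s , refl , ns , ds
      with arrow-body (ctor [] ∷ []) (¬Premise-into-Y (inj₁ refl)) ns ds
    ...   | s' , refl , ns' , ds' =
      constructors-omit-x (suc (size s')) (ctor (output oA ∷ Y ∷ []) ∷ ctor [] ∷ [])
        ≤-refl ns' ds'

corollary2p1p5 : ∀ (A B : Type) → IsOutput A → IsOutput B →
    IsOutput (A ∧ B) × IsOutput (A ∨ B) × IsOutput (L A)
corollary2p1p5 A B oA oB = ∧-output oA oB , ∨-output oA oB , L-output oA
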